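{- Let $n>1$ and let $t$ be an $n$-totative number. Then there exist an $(n-1)$-totative number $t'$ and an integer $k$ with $0\leq k<p_n$ such that $t=t'+k\,\#(n-1)$.
   Context: $p_i$ denotes the $i$th prime. The primorial is $\#(0)=1$ and $\#(m)=\prod_{i=1}^{m}p_i$ for $m\geq 1$. The $m$-primorial set is $\{2,3,\ldots,\#(m),\#(m)+1\}$, and an $m$-totative number is an element of the $m$-primorial set that is coprime to $\#(m)$. -}

module Defs where

open import Data.Nat using (ℕ; zero; suc; _+_; _*_; _!; _≤_; _<_)
open import Data.Nat.Primality using (Prime; prime?)
open import Data.Nat.Coprimality using (Coprime)
open import Data.Product using (_×_)
open import Relation.Nullary using (yes; no)

firstPrimeFrom : ℕ → ℕ → ℕ
firstPrimeFrom zero    m = m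
firstPrimeFrom (suc f) m with prime? m
... | yes _ = m
... | no  _ = firstPrimeFrom f (suc m)

-- the least prime > m (by Euclid, some prime lies in (m, m! + 1])
nextPrime : ℕ → ℕ
nextPrime m = firstPrimeFrom (m !) (suc m)

-- p i = the i-th prime, 1-indexed: p 1 = 2, p 2 = 3, ...
-- (p 0 is a junk value 2 and is never used)
p : ℕ → ℕ
p zero          = 2
p (suc zero)    = 2
p (suc (suc i)) = nextPrime (p (suc i))

primorial : ℕ → ℕ
primorial zero    = 1
primorial (suc m) = primorial m * p (suc m)

InPrimorialSet : ℕ → ℕ → Set
InPrimorialSet m x = 2 ≤ x × x ≤ primorial m + 1

Totative : ℕ → ℕ → Set
Totative m t = InPrimorialSet m t × Coprime t (primorial m)

-- Write t = 2 + u and divide u by #(n-1): the remainder part t' = 2 + (u mod #(n-1)) lies in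
-- {2, …, #(n-1)+1}, the quotient is below p_n because t − 2 < #(n) = #(n-1) p_n, and any common
-- divisor of t' and #(n-1) divides both t = t' + k #(n-1) and #(n), hence is 1.
-- The hypothesis n > 1 only serves to exclude n = 0; the decomposition also holds for n = 1.
module Submission where

open import Defs
open import Data.Nat using (ℕ; zero; suc; _+_; _*_; _<_; _≤_; _∸_; _/_; _%_; NonZero; >-nonZero; z≤n; s≤s; _!)
open import Data.Nat.Properties using (≤-refl; ≤-trans; n≤1+n; ≤-pred; +-comm; *-comm; m*n≢0)
open import Data.Nat.DivMod using (m≡m%n+[m/n]*n; m%n<n; m<n*o⇒m/o<n)
open import Data.Nat.Divisibility using (∣m∣n⇒∣m+n; ∣n⇒∣m*n; ∣m⇒∣m*n)
open import Data.Nat.Primality using (prime?)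
open import Data.Nat.Coprimality using (Coprime)
open import Data.Product using (Σ; _×_; _,_)
open import Relation.Nullary using (yes; no)
open import Relation.Binary.PropositionalEquality using (_≡_; cong; subst)

firstPrimeFrom-≥ : ∀ fuel m → m ≤ firstPrimeFrom fuel m
firstPrimeFrom-≥ zero       m = ≤-refl
firstPrimeFrom-≥ (suc fuel) m with prime? m
... | yes _ = ≤-refl
... | no  _ = ≤-trans (n≤1+n m) (firstPrimeFrom-≥ fuel (suc m))

p-nonZero : ∀ i → NonZero (p i)
p-nonZero zero          = _
p-nonZero (suc zero)    = _
p-nonZero (suc (suc i)) = >-nonZero (≤-trans (s≤s z≤n) (firstPrimeFrom-≥ (p (suc i) !) (suc (p (suc i)))))

primorial-nonZero : ∀ m → NonZero (primorial m)
primorial-nonZero zero    = _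
primorial-nonZero (suc m) = m*n≢0 (primorial m) (p (suc m)) {{primorial-nonZero m}} {{p-nonZero (suc m)}}

coprime-dropMultiple : ∀ {a k b c} → Coprime (a + k * b) (b * c) → Coprime a b
coprime-dropMultiple {k = k} {c = c} coprime (d∣a , d∣b) =
  coprime (∣m∣n⇒∣m+n d∣a (∣n⇒∣m*n k d∣b) , ∣m⇒∣m*n c d∣b)

shifted-divMod : ∀ b c .{{_ : NonZero b}} t → 2 ≤ t → t ≤ b * c + 1 →
  Σ ℕ (λ t' → Σ ℕ (λ k → (2 ≤ t' × t' ≤ b + 1) × k < c × t ≡ t' + k * b))
shifted-divMod b c (suc zero) (s≤s ()) _
shifted-divMod b c (suc (suc u)) _ t≤bc+1 =
  2 + u % b , u / b , (s≤s (s≤s z≤n) , remainder≤b+1) , m<n*o⇒m/o<n u<c*b ,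
  cong (2 +_) (m≡m%n+[m/n]*n u b)
  where
  remainder≤b+1 : 2 + u % b ≤ b + 1
  remainder≤b+1 = subst (2 + u % b ≤_) (+-comm 1 b) (s≤s (m%n<n u b))

  u<c*b : u < c * b
  u<c*b = subst (u <_) (*-comm b c) (≤-pred (subst (2 + u ≤_) (+-comm (b * c) 1) t≤bc+1))

totative-split : ∀ m t → Totative (suc m) t →
  Σ ℕ (λ t' → Σ ℕ (λ k → Totative m t' × k < p (suc m) × t ≡ t' + k * primorial m))
totative-split m t ((2≤t , t≤#+1) , coprime)
  with shifted-divMod (primorial m) (p (suc m)) {{primorial-nonZero m}} t 2≤t t≤#+1
... | t' , k , inPrimorialSet , k<p , t≡ =
  t' , k , (inPrimorialSet , coprime-dropMultiple {k = k} (subst (λ x → Coprime x _) t≡ coprime)) , k<p , t≡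

corollary1 : (n : ℕ) → 1 < n → (t : ℕ) → Totative n t →
    Σ ℕ (λ t' → Σ ℕ (λ k → Totative (n ∸ 1) t' × k < p n × t ≡ t' + k * primorial (n ∸ 1)))
corollary1 zero    ()
corollary1 (suc n) _ = totative-split n
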